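{- Let $d$ be an integer. Let $T=\{T_1,\dots,T_l\}$ be a collection of pairwise distinct finite sets, and for each $i=1,\dots,l$ let $S^{(i)}=\{S^{(i)}_1,\dots,S^{(i)}_{m_i}\}$ be a collection of finite sets, where all the sets $S^{(i)}_j$ ($1\le i\le l$, $1\le j\le m_i$) are pairwise distinct; put $S=S^{(1)}\cup\cdots\cup S^{(l)}$. Assume $T_i\subset S^{(i)}_j$ for all $i,j$. If $D_d(T)>0$ and $D_d(S^{(i)})>0$ for all $i$, then $D_d(S)>0$.
   Context: For a finite set $X$ put $\operatorname{codim}_d(X)=d+1-|X|$. For a collection $\{T_1,\dots,T_l\}$ of pairwise distinct finite sets put $\rho_d(\{T_1,\dots,T_l\})=\sum_{i=1}^l\operatorname{codim}_d(T_i)$ and $D_d(\{T_1,\dots,T_l\})=\operatorname{codim}_d(T_1\cap\cdots\cap T_l)-\rho_d(\{T_1,\dots,T_l\})$; equivalently $D_d(\{T_1,\dots,T_l\})=-(l-1)(d+1)+|T_1|+\cdots+|T_l|-|T_1\cap\cdots\cap T_l|$. -}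

module Defs where

open import Data.Nat using (ℕ)
open import Data.Integer using (ℤ; +_; _+_; _-_)
open import Data.List using (List; []; _∷_; foldr)
open import Data.Fin.Subset using (Subset; _∩_; ⊤; ∣_∣)

-- Finite sets are modelled as subsets of a common finite ground set Fin n
-- (any finite family of finite sets lives inside such a ground set).

codim : ∀ {n} → ℤ → Subset n → ℤ
codim d X = d + + 1 - + ∣ X ∣

-- intersection of a (nonempty) collection; the empty intersection is ⊤
-- but the statement only applies ⋂ to nonempty collections.
⋂ : ∀ {n} → List (Subset n) → Subset n
⋂ = foldr _∩_ ⊤

ρ : ∀ {n} → ℤ → List (Subset n) → ℤ
ρ d [] = + 0
ρ d (X ∷ Xs) = codim d X + ρ d Xs

D : ∀ {n} → ℤ → List (Subset n) → ℤ
D d Ts = codim d (⋂ Ts) - ρ d Ts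

module Submission where

-- Write e = d + 1.  Unfolding the definition of D on a
-- cons-cell and using inclusion–exclusion  |X| + |Y| = |X ∪ Y| + |X ∩ Y|
-- gives the recursion
--     D (X ∷ Xs) = D Xs + (|X ∪ ⋂ Xs| - e),
-- so D is a sum of terms |Tᵢ ∪ (Tᵢ₊₁ ∩ ⋯ ∩ Tₗ)| - e, each monotone in the
-- sets involved.  Hence D is monotone under pointwise inclusion of lists.
-- Next, grouping a concatenation S = S⁽¹⁾ ++ ⋯ ++ S⁽ˡ⁾ by blocks gives the
-- decomposition
--     D (concat S) = Σᵢ D (S⁽ⁱ⁾) + D (⋂ S⁽¹⁾, …, ⋂ S⁽ˡ⁾).
-- Since Tᵢ ⊆ ⋂ S⁽ⁱ⁾, monotonicity gives D T ≤ D (⋂ S⁽¹⁾, …, ⋂ S⁽ˡ⁾), and as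
-- every D (S⁽ⁱ⁾) is positive, D (concat S) ≥ D T > 0.

open import Defs
open import Data.Nat using (ℕ)
open import Data.Integer using (ℤ; +_; _>_)
open import Data.List using (List; []; concat)
open import Data.List.Relation.Unary.All using (All)
open import Data.List.Relation.Unary.Unique.Propositional using (Unique)
open import Data.List.Relation.Binary.Pointwise using (Pointwise)
open import Data.Fin.Subset using (Subset; _⊆_)
open import Relation.Binary.PropositionalEquality using (_≢_)

import Data.Nat as ℕ
import Data.Nat.Properties as ℕ
open import Data.Integer using (_+_; _-_; -_; _≤_; +≤+; NonNegative; nonNegative)
import Data.Integer.Properties as ℤ
open import Data.Integer.Tactic.RingSolver using (solve-∀)
open import Data.List using (_∷_; _++_; map)
open import Data.List.Relation.Unary.All using ([]; _∷_)
open import Data.List.Relation.Binary.Pointwise using ([]; _∷_)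
open import Data.Fin.Subset using (_∩_; _∪_; ∣_∣; inside; outside)
open import Data.Fin.Subset.Properties
  using (∩-assoc; ∩-identityˡ; x∈p∩q⁺; x∈p∩q⁻; x∈p∪q⁺; x∈p∪q⁻; ⊆⊤; ⊆-refl; p⊆q⇒∣p∣≤∣q∣)
open import Data.Vec using ([]; _∷_)
open import Data.Product using (_,_)
open import Data.Sum using (inj₁; inj₂)
open import Relation.Binary.PropositionalEquality
  using (_≡_; refl; sym; trans; cong; module ≡-Reasoning)

private
  variable
    n : ℕ

inclusion-exclusion : (X Y : Subset n) → ∣ X ∪ Y ∣ ℕ.+ ∣ X ∩ Y ∣ ≡ ∣ X ∣ ℕ.+ ∣ Y ∣
inclusion-exclusion []            []            = refl
inclusion-exclusion (outside ∷ X) (outside ∷ Y) = inclusion-exclusion X Y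
inclusion-exclusion (outside ∷ X) (inside  ∷ Y) =
  trans (cong ℕ.suc (inclusion-exclusion X Y)) (sym (ℕ.+-suc ∣ X ∣ ∣ Y ∣))
inclusion-exclusion (inside  ∷ X) (outside ∷ Y) = cong ℕ.suc (inclusion-exclusion X Y)
inclusion-exclusion (inside  ∷ X) (inside  ∷ Y) = cong ℕ.suc (begin
  ∣ X ∪ Y ∣ ℕ.+ ℕ.suc ∣ X ∩ Y ∣   ≡⟨ ℕ.+-suc ∣ X ∪ Y ∣ ∣ X ∩ Y ∣ ⟩
  ℕ.suc (∣ X ∪ Y ∣ ℕ.+ ∣ X ∩ Y ∣) ≡⟨ cong ℕ.suc (inclusion-exclusion X Y) ⟩
  ℕ.suc (∣ X ∣ ℕ.+ ∣ Y ∣)         ≡⟨ ℕ.+-suc ∣ X ∣ ∣ Y ∣ ⟨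
  ∣ X ∣ ℕ.+ ℕ.suc ∣ Y ∣           ∎)
  where open ≡-Reasoning

∪-mono-⊆ : {X X′ Y Y′ : Subset n} → X ⊆ X′ → Y ⊆ Y′ → X ∪ Y ⊆ X′ ∪ Y′
∪-mono-⊆ {X = X} {Y = Y} X⊆X′ Y⊆Y′ x∈ with x∈p∪q⁻ X Y x∈
... | inj₁ x∈X = x∈p∪q⁺ (inj₁ (X⊆X′ x∈X))
... | inj₂ x∈Y = x∈p∪q⁺ (inj₂ (Y⊆Y′ x∈Y))

∩-mono-⊆ : {X X′ Y Y′ : Subset n} → X ⊆ X′ → Y ⊆ Y′ → X ∩ Y ⊆ X′ ∩ Y′
∩-mono-⊆ {X = X} {Y = Y} X⊆X′ Y⊆Y′ x∈ with x∈p∩q⁻ X Y x∈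
... | x∈X , x∈Y = x∈p∩q⁺ (X⊆X′ x∈X , Y⊆Y′ x∈Y)

⊆-⋂ : {X : Subset n} (Ys : List (Subset n)) → All (X ⊆_) Ys → X ⊆ ⋂ Ys
⊆-⋂ []       []           = ⊆⊤
⊆-⋂ (Y ∷ Ys) (X⊆Y ∷ X⊆Ys) x∈ = x∈p∩q⁺ (X⊆Y x∈ , ⊆-⋂ Ys X⊆Ys x∈)

⊆-⋂-blocks : {T : List (Subset n)} {S : List (List (Subset n))} →
             Pointwise (λ t s → All (t ⊆_) s) T S → Pointwise _⊆_ T (map ⋂ S)
⊆-⋂-blocks []                        = []
⊆-⋂-blocks {S = s ∷ _} (t⊆s ∷ T⊆S) = ⊆-⋂ s t⊆s ∷ ⊆-⋂-blocks T⊆S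

⋂-mono : {Xs Ys : List (Subset n)} → Pointwise _⊆_ Xs Ys → ⋂ Xs ⊆ ⋂ Ys
⋂-mono []           = ⊆-refl
⋂-mono (X⊆Y ∷ Xs⊆Ys) = ∩-mono-⊆ X⊆Y (⋂-mono Xs⊆Ys)

D-∷ : (d : ℤ) (X : Subset n) (Xs : List (Subset n)) →
      D d (X ∷ Xs) ≡ D d Xs + (+ ∣ X ∪ ⋂ Xs ∣ - (d + + 1))
D-∷ d X Xs = begin
  (e - i) - ((e - x) + r)           ≡⟨ cong (λ j → (e - j) - ((e - x) + r)) i≡x+y-u ⟩
  (e - (x + y - u)) - ((e - x) + r) ≡⟨ rearrange e x y u r ⟩
  ((e - y) - r) + (u - e)           ∎
  where
  open ≡-Reasoning
  e r x y u i : ℤ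
  e = d + + 1
  r = ρ d Xs
  x = + ∣ X ∣
  y = + ∣ ⋂ Xs ∣
  u = + ∣ X ∪ ⋂ Xs ∣
  i = + ∣ X ∩ ⋂ Xs ∣

  i≡x+y-u : i ≡ x + y - u
  i≡x+y-u = begin
    i             ≡⟨ cancel u i ⟩
    (u + i) - u   ≡⟨ cong (_- u) (ℤ.pos-+ ∣ X ∪ ⋂ Xs ∣ ∣ X ∩ ⋂ Xs ∣) ⟨
    + (∣ X ∪ ⋂ Xs ∣ ℕ.+ ∣ X ∩ ⋂ Xs ∣) - u
      ≡⟨ cong (λ k → + k - u) (inclusion-exclusion X (⋂ Xs)) ⟩
    + (∣ X ∣ ℕ.+ ∣ ⋂ Xs ∣) - u   ≡⟨ cong (_- u) (ℤ.pos-+ ∣ X ∣ ∣ ⋂ Xs ∣) ⟩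
    x + y - u     ∎
    where
    cancel : ∀ a b → b ≡ (a + b) - a
    cancel = solve-∀

  rearrange : ∀ e x y u r → (e - (x + y - u)) - ((e - x) + r) ≡ ((e - y) - r) + (u - e)
  rearrange = solve-∀

D-mono : (d : ℤ) {Xs Ys : List (Subset n)} → Pointwise _⊆_ Xs Ys → D d Xs ≤ D d Ys
D-mono d []                              = ℤ.≤-refl
D-mono d {X ∷ Xs} {Y ∷ Ys} (X⊆Y ∷ Xs⊆Ys) = begin
  D d (X ∷ Xs)                            ≡⟨ D-∷ d X Xs ⟩
  D d Xs + (+ ∣ X ∪ ⋂ Xs ∣ - (d + + 1))   ≤⟨ ℤ.+-mono-≤ (D-mono d Xs⊆Ys) union-grows ⟩
  D d Ys + (+ ∣ Y ∪ ⋂ Ys ∣ - (d + + 1))   ≡⟨ D-∷ d Y Ys ⟨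
  D d (Y ∷ Ys)                            ∎
  where
  open ℤ.≤-Reasoning
  union-grows : + ∣ X ∪ ⋂ Xs ∣ - (d + + 1) ≤ + ∣ Y ∪ ⋂ Ys ∣ - (d + + 1)
  union-grows = ℤ.+-monoˡ-≤ (- (d + + 1)) (+≤+ (p⊆q⇒∣p∣≤∣q∣ (∪-mono-⊆ X⊆Y (⋂-mono Xs⊆Ys))))

ΣD : ℤ → List (List (Subset n)) → ℤ
ΣD d []       = + 0
ΣD d (s ∷ S) = D d s + ΣD d S

⋂-++ : (Xs Ys : List (Subset n)) → ⋂ (Xs ++ Ys) ≡ ⋂ Xs ∩ ⋂ Ys
⋂-++ []       Ys = sym (∩-identityˡ (⋂ Ys))
⋂-++ (X ∷ Xs) Ys = trans (cong (X ∩_) (⋂-++ Xs Ys)) (sym (∩-assoc X (⋂ Xs) (⋂ Ys)))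

⋂-concat : (S : List (List (Subset n))) → ⋂ (concat S) ≡ ⋂ (map ⋂ S)
⋂-concat []       = refl
⋂-concat (s ∷ S) = trans (⋂-++ s (concat S)) (cong (⋂ s ∩_) (⋂-concat S))

ρ-++ : (d : ℤ) (Xs Ys : List (Subset n)) → ρ d (Xs ++ Ys) ≡ ρ d Xs + ρ d Ys
ρ-++ d []       Ys = sym (ℤ.+-identityˡ (ρ d Ys))
ρ-++ d (X ∷ Xs) Ys =
  trans (cong (λ r → codim d X + r) (ρ-++ d Xs Ys)) (sym (ℤ.+-assoc (codim d X) (ρ d Xs) (ρ d Ys)))

-- Replacing each block by its intersection changes ρ by exactly Σᵢ D (S⁽ⁱ⁾),
-- since codim (⋂ s) = D s + ρ s by definition of D.
ρ-blocks : (d : ℤ) (S : List (List (Subset n))) → ρ d (map ⋂ S) ≡ ΣD d S + ρ d (concat S)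
ρ-blocks d []       = refl
ρ-blocks d (s ∷ S) = begin
  codim d (⋂ s) + ρ d (map ⋂ S)
    ≡⟨ cong (λ r → codim d (⋂ s) + r) (ρ-blocks d S) ⟩
  codim d (⋂ s) + (ΣD d S + ρ d (concat S))
    ≡⟨ regroup (codim d (⋂ s)) (ρ d s) (ΣD d S) (ρ d (concat S)) ⟩
  (codim d (⋂ s) - ρ d s + ΣD d S) + (ρ d s + ρ d (concat S))
    ≡⟨ cong (λ r → ΣD d (s ∷ S) + r) (ρ-++ d s (concat S)) ⟨
  ΣD d (s ∷ S) + ρ d (s ++ concat S)
    ∎
  where
  open ≡-Reasoning
  regroup : ∀ c p σ r → c + (σ + r) ≡ (c - p + σ) + (p + r)
  regroup = solve-∀

D-concat : (d : ℤ) (S : List (List (Subset n))) → D d (concat S) ≡ ΣD d S + D d (map ⋂ S)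
D-concat d S = begin
  codim d (⋂ (concat S)) - ρ d (concat S)     ≡⟨ cong (λ W → codim d W - ρ d (concat S)) (⋂-concat S) ⟩
  c - ρ d (concat S)                          ≡⟨ regroup c (ΣD d S) (ρ d (concat S)) ⟩
  ΣD d S + (c - (ΣD d S + ρ d (concat S)))    ≡⟨ cong (λ r → ΣD d S + (c - r)) (ρ-blocks d S) ⟨
  ΣD d S + (c - ρ d (map ⋂ S))                ∎
  where
  open ≡-Reasoning
  c : ℤ
  c = codim d (⋂ (map ⋂ S))
  regroup : ∀ c σ r → c - r ≡ σ + (c - (σ + r))
  regroup = solve-∀

ΣD-nonneg : (d : ℤ) (S : List (List (Subset n))) → All (λ s → D d s > + 0) S → + 0 ≤ ΣD d S
ΣD-nonneg d []       []           = ℤ.≤-refl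
ΣD-nonneg d (s ∷ S) (Ds>0 ∷ DS>0) = ℤ.+-mono-≤ (ℤ.<⇒≤ Ds>0) (ΣD-nonneg d S DS>0)

lemma3p5 : (n : ℕ) (d : ℤ) (T : List (Subset n)) (S : List (List (Subset n))) →
    T ≢ [] →
    All (λ Si → Si ≢ []) S →
    Unique T →
    Unique (concat S) →
    Pointwise (λ Ti Si → All (λ X → Ti ⊆ X) Si) T S →
    D d T > + 0 →
    All (λ Si → D d Si > + 0) S →
    D d (concat S) > + 0
lemma3p5 n d T S _ _ _ _ T⊆S DT>0 DS>0 = begin-strict
  + 0                   <⟨ DT>0 ⟩
  D d T                 ≤⟨ D-mono d (⊆-⋂-blocks T⊆S) ⟩
  D d (map ⋂ S)         ≤⟨ ℤ.i≤j+i (D d (map ⋂ S)) (ΣD d S) {{ΣD≥0}} ⟩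
  ΣD d S + D d (map ⋂ S) ≡⟨ D-concat d S ⟨
  D d (concat S)        ∎
  where
  open ℤ.≤-Reasoning
  ΣD≥0 : NonNegative (ΣD d S)
  ΣD≥0 = nonNegative (ΣD-nonneg d S DS>0)
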